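{- Let $n,m$ be positive integers and let $A$ be a binary $n\times m$ matrix in $\mathfrak{D}_{n\times m}$, with $r(A)=\langle x_1,\dots,x_n\rangle$ and $c(A)=\langle y_1,\dots,y_m\rangle$. Let $s$ be the number of entries equal to $1$ in the first row of $A$ and $t$ the number of entries equal to $1$ in the first column of $A$ (so $0\le s\le m$, $0\le t\le n$). Then $x_1=(2^s-1)2^{m-s}=2^m-2^{m-s}$ and $y_1=(2^t-1)2^{n-t}=2^n-2^{n-t}$.
   Context: For a binary $n\times m$ matrix $A=(a_{ij})$, $r(A)=\langle x_1,\dots,x_n\rangle$ with $x_i=\sum_{j=1}^m a_{ij}2^{m-j}$ and $c(A)=\langle y_1,\dots,y_m\rangle$ with $y_j=\sum_{i=1}^n a_{ij}2^{n-i}$. $\mathfrak{D}_{n\times m}$ is the set of binary $n\times m$ matrices with $x_1\ge\cdots\ge x_n$ and $y_1\ge\cdots\ge y_m$. -}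

module Defs where

open import Data.Nat using (ℕ; zero; suc; _+_; _*_; _^_; _≥_)
open import Data.Bool using (Bool; true; false)
open import Data.Fin using (Fin; zero; suc)
open import Data.Product using (_×_)

-- A binary n × m matrix: entry (i , j) (0-indexed) is A i j.
Matrix : ℕ → ℕ → Set
Matrix n m = Fin n → Fin m → Bool

bit : Bool → ℕ
bit true  = 1
bit false = 0

bin : (k : ℕ) → (Fin k → Bool) → ℕ
bin zero    b = 0
bin (suc k) b = bit (b zero) * 2 ^ k + bin k (λ j → b (suc j))

ones : (k : ℕ) → (Fin k → Bool) → ℕ
ones zero    b = 0
ones (suc k) b = bit (b zero) + ones k (λ j → b (suc j))

rowVal : ∀ {n m} → Matrix n m → Fin n → ℕ
rowVal {n} {m} A i = bin m (λ j → A i j)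

colVal : ∀ {n m} → Matrix n m → Fin m → ℕ
colVal {n} {m} A j = bin n (λ i → A i j)

NonIncreasing : ∀ {k} → (Fin k → ℕ) → Set
NonIncreasing {k} f = ∀ (i j : Fin k) → Data.Fin._≤_ i j → f i ≥ f j

InD : ∀ {n m} → Matrix n m → Set
InD A = NonIncreasing (rowVal A) × NonIncreasing (colVal A)

{-# OPTIONS --safe #-}
-- Monotone columns force the first row to be 1…10…0: if A 0 j' = 1 and j ≤ j', then
-- y_j ≥ y_j' ≥ 2^(n-1), which a column with leading digit 0 cannot reach. A binary word
-- 1…10…0 of length k with s ones is 2^k − 2^(k−s), and 2^k − 2^(k−s) = (2^s − 1)·2^(k−s).
-- The first column is handled in the same way, with the roles of rows and columns swapped.
module Submission where

open import Defs
open import Data.Nat using (ℕ; zero; suc; _+_; _*_; _∸_; _^_; _≤_; _<_; z≤n; s≤s)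
open import Data.Nat.Properties
open import Data.Fin using (Fin; zero; suc)
open import Data.Bool using (Bool; true; false)
open import Data.Product using (_×_; _,_)
open import Function using (_∘_; flip)
open import Relation.Nullary using (contradiction)
open import Relation.Binary.PropositionalEquality
  using (_≡_; refl; sym; trans; cong; cong₂; module ≡-Reasoning)

OnesFirst : (k : ℕ) → (Fin k → Bool) → Set
OnesFirst k b = ∀ (i j : Fin k) → Data.Fin._≤_ i j → b j ≡ true → b i ≡ true

onesFirst-tail : ∀ {k} {b : Fin (suc k) → Bool} → OnesFirst (suc k) b → OnesFirst k (b ∘ suc)
onesFirst-tail b↓ i j i≤j = b↓ (suc i) (suc j) (s≤s i≤j)

onesFirst-headFalse⇒allFalse : ∀ {k} {b : Fin (suc k) → Bool} →
  OnesFirst (suc k) b → b zero ≡ false → ∀ j → b j ≡ false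
onesFirst-headFalse⇒allFalse {b = b} b↓ b₀≡false j with b j in bj≡true
... | false = refl
... | true  = contradiction (trans (sym (b↓ zero j z≤n bj≡true)) b₀≡false) λ ()

bit≤1 : ∀ x → bit x ≤ 1
bit≤1 true  = s≤s z≤n
bit≤1 false = z≤n

ones≤k : ∀ k (b : Fin k → Bool) → ones k b ≤ k
ones≤k zero    b = z≤n
ones≤k (suc k) b = +-mono-≤ (bit≤1 (b zero)) (ones≤k k (b ∘ suc))

allFalse⇒bin≡0 : ∀ k (b : Fin k → Bool) → (∀ j → b j ≡ false) → bin k b ≡ 0
allFalse⇒bin≡0 zero    b b≡false = refl
allFalse⇒bin≡0 (suc k) b b≡false rewrite b≡false zero =
  allFalse⇒bin≡0 k (b ∘ suc) (b≡false ∘ suc)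

allFalse⇒ones≡0 : ∀ k (b : Fin k → Bool) → (∀ j → b j ≡ false) → ones k b ≡ 0
allFalse⇒ones≡0 zero    b b≡false = refl
allFalse⇒ones≡0 (suc k) b b≡false rewrite b≡false zero =
  allFalse⇒ones≡0 k (b ∘ suc) (b≡false ∘ suc)

1*2^k+2^k≡2^[1+k] : ∀ k → 1 * 2 ^ k + 2 ^ k ≡ 2 ^ suc k
1*2^k+2^k≡2^[1+k] k = cong₂ _+_ (*-identityˡ (2 ^ k)) (sym (+-identityʳ (2 ^ k)))

bin<2^k : ∀ k (b : Fin k → Bool) → bin k b < 2 ^ k
bin<2^k zero    b = s≤s z≤n
bin<2^k (suc k) b = begin-strict
  bit (b zero) * 2 ^ k + bin k (b ∘ suc) <⟨ +-monoʳ-< _ (bin<2^k k (b ∘ suc)) ⟩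
  bit (b zero) * 2 ^ k + 2 ^ k           ≤⟨ +-monoˡ-≤ (2 ^ k) (*-monoˡ-≤ (2 ^ k) (bit≤1 (b zero))) ⟩
  1 * 2 ^ k + 2 ^ k                      ≡⟨ 1*2^k+2^k≡2^[1+k] k ⟩
  2 ^ suc k                              ∎
  where open ≤-Reasoning

headFalse⇒bin<2^k : ∀ k (b : Fin (suc k) → Bool) → b zero ≡ false → bin (suc k) b < 2 ^ k
headFalse⇒bin<2^k k b b₀≡false rewrite b₀≡false = bin<2^k k (b ∘ suc)

headTrue⇒2^k≤bin : ∀ k (b : Fin (suc k) → Bool) → b zero ≡ true → 2 ^ k ≤ bin (suc k) b
headTrue⇒2^k≤bin k b b₀≡true rewrite b₀≡true =
  ≤-trans (≤-reflexive (sym (*-identityˡ (2 ^ k)))) (m≤m+n (1 * 2 ^ k) (bin k (b ∘ suc)))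

nonIncreasingRows⇒firstColumn-onesFirst : ∀ {n m} (A : Matrix n (suc m)) →
  NonIncreasing (rowVal A) → OnesFirst n (λ i → A i zero)
nonIncreasingRows⇒firstColumn-onesFirst {m = m} A rows↓ i j i≤j Aj₀≡true with A i zero in Ai₀
... | true  = refl
... | false = contradiction (begin-strict
  rowVal A i <⟨ headFalse⇒bin<2^k m (A i) Ai₀ ⟩
  2 ^ m      ≤⟨ headTrue⇒2^k≤bin m (A j) Aj₀≡true ⟩
  rowVal A j ≤⟨ rows↓ i j i≤j ⟩
  rowVal A i ∎) (<-irrefl refl)
  where open ≤-Reasoning

onesFirst⇒bin+2^[k∸ones]≡2^k : ∀ k (b : Fin k → Bool) → OnesFirst k b →
  bin k b + 2 ^ (k ∸ ones k b) ≡ 2 ^ k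
onesFirst⇒bin+2^[k∸ones]≡2^k zero    b b↓ = refl
onesFirst⇒bin+2^[k∸ones]≡2^k (suc k) b b↓ with b zero in b₀
... | false
  rewrite allFalse⇒bin≡0 k (b ∘ suc) (onesFirst-headFalse⇒allFalse b↓ b₀ ∘ suc)
        | allFalse⇒ones≡0 k (b ∘ suc) (onesFirst-headFalse⇒allFalse b↓ b₀ ∘ suc) = refl
... | true = begin
  1 * 2 ^ k + bin k (b ∘ suc) + 2 ^ (k ∸ ones k (b ∘ suc))
    ≡⟨ +-assoc (1 * 2 ^ k) _ _ ⟩
  1 * 2 ^ k + (bin k (b ∘ suc) + 2 ^ (k ∸ ones k (b ∘ suc)))
    ≡⟨ cong (1 * 2 ^ k +_) (onesFirst⇒bin+2^[k∸ones]≡2^k k (b ∘ suc) (onesFirst-tail b↓)) ⟩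
  1 * 2 ^ k + 2 ^ k
    ≡⟨ 1*2^k+2^k≡2^[1+k] k ⟩
  2 ^ suc k ∎
  where open ≡-Reasoning

[2^s∸1]*2^[k∸s]≡2^k∸2^[k∸s] : ∀ {s k} → s ≤ k → (2 ^ s ∸ 1) * 2 ^ (k ∸ s) ≡ 2 ^ k ∸ 2 ^ (k ∸ s)
[2^s∸1]*2^[k∸s]≡2^k∸2^[k∸s] {s} {k} s≤k = begin
  (2 ^ s ∸ 1) * 2 ^ (k ∸ s)             ≡⟨ *-distribʳ-∸ (2 ^ (k ∸ s)) (2 ^ s) 1 ⟩
  2 ^ s * 2 ^ (k ∸ s) ∸ 1 * 2 ^ (k ∸ s) ≡⟨ cong₂ _∸_ (sym (^-distribˡ-+-* 2 s (k ∸ s))) (*-identityˡ (2 ^ (k ∸ s))) ⟩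
  2 ^ (s + (k ∸ s)) ∸ 2 ^ (k ∸ s)       ≡⟨ cong (λ e → 2 ^ e ∸ 2 ^ (k ∸ s)) (m+[n∸m]≡n s≤k) ⟩
  2 ^ k ∸ 2 ^ (k ∸ s)                   ∎
  where open ≡-Reasoning

onesFirst⇒bin≡ : ∀ k (b : Fin k → Bool) → OnesFirst k b →
  let s = ones k b in
  (bin k b ≡ (2 ^ s ∸ 1) * 2 ^ (k ∸ s)) × (bin k b ≡ 2 ^ k ∸ 2 ^ (k ∸ s))
onesFirst⇒bin≡ k b b↓ =
  trans bin≡2^k∸2^[k∸s] (sym ([2^s∸1]*2^[k∸s]≡2^k∸2^[k∸s] (ones≤k k b))) , bin≡2^k∸2^[k∸s]
  where
  bin≡2^k∸2^[k∸s] : bin k b ≡ 2 ^ k ∸ 2 ^ (k ∸ ones k b)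
  bin≡2^k∸2^[k∸s] = trans (sym (m+n∸n≡m (bin k b) (2 ^ (k ∸ ones k b))))
                          (cong (_∸ 2 ^ (k ∸ ones k b)) (onesFirst⇒bin+2^[k∸ones]≡2^k k b b↓))

corollary2 : (n m : ℕ) → (A : Matrix (suc n) (suc m)) → InD A →
    let s = ones (suc m) (λ j → A zero j)
        t = ones (suc n) (λ i → A i zero)
    in (rowVal A zero ≡ (2 ^ s ∸ 1) * 2 ^ (suc m ∸ s))
     × (rowVal A zero ≡ 2 ^ suc m ∸ 2 ^ (suc m ∸ s))
     × (colVal A zero ≡ (2 ^ t ∸ 1) * 2 ^ (suc n ∸ t))
     × (colVal A zero ≡ 2 ^ suc n ∸ 2 ^ (suc n ∸ t))
corollary2 n m A (rows↓ , cols↓) =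
  let (row₀-product , row₀-difference) =
        onesFirst⇒bin≡ (suc m) (A zero) (nonIncreasingRows⇒firstColumn-onesFirst (flip A) cols↓)
      (col₀-product , col₀-difference) =
        onesFirst⇒bin≡ (suc n) (λ i → A i zero) (nonIncreasingRows⇒firstColumn-onesFirst A rows↓)
  in row₀-product , row₀-difference , col₀-product , col₀-difference
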